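{- Let $G$ be a graph with diameter at most $2$ and minimum degree $\delta\ge 2$. Then $G$ has an edge cut of size $\delta$ that is not the set of edges incident to a single vertex if and only if $V(G)$ can be partitioned into sets $A, B, C$ such that: (1) the induced subgraph $G[A]$ is isomorphic to $K_\delta$ and $|B\cup C|\ge\delta$; (2) each vertex in $A$ has exactly one neighbour in $B$ and no neighbours in $C$; (3) each vertex in $B$ has at least one neighbour in $A$; and (4) each vertex in $B$ is adjacent to each vertex in $C$.
   Context: An edge cut is a set of edges whose removal disconnects the graph. -}

module Defs where

open import Data.Nat using (ℕ; zero; suc; _+_; _≤_)
open import Data.Bool using (Bool; true; false; _∧_; _∨_; not; if_then_else_)
open import Data.Fin using (Fin; toℕ; _≟_)
open import Data.Nat using (_<ᵇ_)
open import Data.List using (List; sum; map; filter; length)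
open import Data.List using () renaming (map to lmap)
open import Data.Fin.Base using ()
open import Data.Vec.Functional using (foldr)
open import Data.Product using (Σ; _×_; ∃; ∃-syntax; _,_)
open import Data.Sum using (_⊎_)
open import Relation.Binary.PropositionalEquality using (_≡_; _≢_)
open import Relation.Nullary using (¬_; does)

record Graph (n : ℕ) : Set where
  field
    adj    : Fin n → Fin n → Bool
    sym    : ∀ u v → adj u v ≡ adj v u
    irrefl : ∀ v → adj v v ≡ false
open Graph public

count : ∀ {n} → (Fin n → Bool) → ℕ
count P = foldr (λ b k → (if b then 1 else 0) + k) 0 P

deg : ∀ {n} → Graph n → Fin n → ℕ
deg G v = count (adj G v)

IsMinDegree : ∀ {n} → Graph n → ℕ → Set
IsMinDegree G δ = (∀ v → δ ≤ deg G v) × (∃[ v ] deg G v ≡ δ)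

DiamAtMost2 : ∀ {n} → Graph n → Set
DiamAtMost2 G = ∀ u v → u ≢ v →
  (adj G u v ≡ true) ⊎ (∃[ w ] (adj G u w ≡ true × adj G w v ≡ true))

data Reach {n : ℕ} (E : Fin n → Fin n → Bool) : Fin n → Fin n → Set where
  here  : ∀ {u} → Reach E u u
  step  : ∀ {u v w} → E u v ≡ true → Reach E v w → Reach E u w

record EdgeSet {n : ℕ} (G : Graph n) : Set where
  field
    mem    : Fin n → Fin n → Bool
    memSym : ∀ u v → mem u v ≡ mem v u
    memSub : ∀ u v → mem u v ≡ true → adj G u v ≡ true
open EdgeSet public

-- number of (unordered) edges in an edge set: pairs u < v in the set
size : ∀ {n} {G : Graph n} → EdgeSet G → ℕ
size F = foldr (λ k m → k + m) 0
  (λ u → count (λ v → mem F u v ∧ (toℕ u <ᵇ toℕ v)))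

remove : ∀ {n} (G : Graph n) → EdgeSet G → Fin n → Fin n → Bool
remove G F u v = adj G u v ∧ not (mem F u v)

IsEdgeCut : ∀ {n} (G : Graph n) → EdgeSet G → Set
IsEdgeCut G F = ∃[ u ] ∃[ v ] ¬ Reach (remove G F) u v

IsStar : ∀ {n} (G : Graph n) → EdgeSet G → Fin n → Set
IsStar G F v = ∀ x y → mem F x y ≡ (adj G x y ∧ (does (x ≟ v) ∨ does (y ≟ v)))

-- labels of a partition of V(G) into A, B, C
data Part : Set where
  pA pB pC : Part

isA isB isC : Part → Bool
isA pA = true
isA _  = false
isB pB = true
isB _  = false
isC pC = true
isC _  = false

GoodPartition : ∀ {n} → Graph n → ℕ → (Fin n → Part) → Set
GoodPartition G δ lab =
  -- (1) G[A] ≅ K_δ : |A| = δ and any two distinct vertices of A are adjacent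
    (count (λ v → isA (lab v)) ≡ δ)
  × (∀ u v → lab u ≡ pA → lab v ≡ pA → u ≢ v → adj G u v ≡ true)
  × (δ ≤ count (λ v → not (isA (lab v))))
  × (∀ v → lab v ≡ pA → count (λ w → adj G v w ∧ isB (lab w)) ≡ 1)
  × (∀ v w → lab v ≡ pA → lab w ≡ pC → adj G v w ≡ false)
  × (∀ v → lab v ≡ pB → ∃[ w ] (lab w ≡ pA × adj G v w ≡ true))
  × (∀ u v → lab u ≡ pB → lab v ≡ pC → adj G u v ≡ true)

-- Let S be the set of vertices reachable from u in G − F. Every edge leaving S, or leaving its
-- complement, lies in F, so a side X has at most |F| = δ edges leaving it. If 2 ≤ |X| < δ, each vertex of X
-- has at least δ + 1 − |X| neighbours outside X, giving more than δ leaving edges; if |X| = 1, F is the star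
-- of its vertex. So both sides have at least δ vertices. By diameter 2 one side X has every vertex adjacent
-- to the other side; then δ ≤ |X| ≤ (edges leaving X) ≤ δ, so |X| = δ, every vertex of X has exactly one
-- neighbour outside X, and minimum degree δ makes X a clique. Take A = X, B = the other vertices with a
-- neighbour in X, and C the rest; diameter 2 gives (4). The edges between A and B are exactly the edges leaving A: there are |A| = δ of them, removing
-- them separates A from B ∪ C, and no vertex lies on all of them.

module Submission where

open import Defs
open import Data.Nat using (ℕ; zero; suc; _+_; _*_; _≤_; _<_; z≤n; s≤s; s≤s⁻¹; _<ᵇ_; _<?_; _≤?_)
open import Data.Nat.Properties hiding (_≟_; suc-injective)
import Data.Nat.Properties as ℕ
open import Data.Bool using (Bool; true; false; _∧_; _∨_; not; if_then_else_; T)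
open import Data.Bool.Properties
  using ( ∨-comm; ∧-comm; ∧-zeroʳ; ∧-identityʳ; ∨-zeroʳ; ∨-identityʳ; ∧-distribʳ-∨
        ; not-injective; ¬-not; not-¬; T-≡)
  renaming (_≟_ to _≟ᵇ_)
open import Data.Fin using (Fin; zero; suc; toℕ; _≟_)
open import Data.Fin.Properties using (toℕ-injective; suc-injective; any?)
open import Data.Product using (_×_; ∃; ∃-syntax; _,_; proj₁; proj₂)
open import Data.Sum using (_⊎_; inj₁; inj₂; [_,_]′)
import Data.Sum
open import Data.Empty using (⊥; ⊥-elim)
open import Data.Unit using (tt)
open import Function using (_∘_)
open import Function.Bundles using (_⇔_; mk⇔; Equivalence)
open import Relation.Binary.PropositionalEquality hiding (sym)
import Relation.Binary.PropositionalEquality as ≡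
open import Relation.Binary.Definitions using (tri<; tri≈; tri>)
open import Relation.Nullary using (¬_; does; yes; no)
open import Relation.Nullary.Decidable using (dec-true; _×-dec_)
open import Algebra.Properties.CommutativeMonoid.Sum +-0-commutativeMonoid
  using (sum; sum-cong-≗; ∑-distrib-+; ∑-comm; sum-remove)

private
  variable
    n : ℕ

-- Counting over Fin n

∧-true⇒ : ∀ {a b} → a ∧ b ≡ true → a ≡ true × b ≡ true
∧-true⇒ {true} {true} _ = refl , refl

∨-true⇒ : ∀ {a b} → a ∨ b ≡ true → a ≡ true ⊎ b ≡ true
∨-true⇒ {true}  _ = inj₁ refl
∨-true⇒ {false} e = inj₂ e

𝟙 : Bool → ℕ
𝟙 b = if b then 1 else 0

𝟙-∨ : ∀ a b → a ∧ b ≡ false → 𝟙 (a ∨ b) ≡ 𝟙 a + 𝟙 b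
𝟙-∨ false b     _ = refl
𝟙-∨ true  false _ = refl

≤-sum : (t : Fin n → ℕ) (i : Fin n) → t i ≤ sum t
≤-sum {suc n} t i = subst (t i ≤_) (≡.sym (sum-remove t)) (m≤m+n _ _)

count≡sum : (P : Fin n → Bool) → count P ≡ sum (𝟙 ∘ P)
count≡sum {zero}  P = refl
count≡sum {suc n} P = cong (𝟙 (P zero) +_) (count≡sum (P ∘ suc))

count-cong : {P Q : Fin n → Bool} → (∀ i → P i ≡ Q i) → count P ≡ count Q
count-cong {zero}  _   = refl
count-cong {suc n} P≗Q = cong₂ _+_ (cong 𝟙 (P≗Q zero)) (count-cong (P≗Q ∘ suc))

count-false : ∀ n → count {n} (λ _ → false) ≡ 0
count-false zero    = refl
count-false (suc n) = count-false n

count-≤ : (P : Fin n → Bool) → count P ≤ n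
count-≤ {zero}  P = z≤n
count-≤ {suc n} P with P zero
... | true  = s≤s (count-≤ (P ∘ suc))
... | false = m≤n⇒m≤1+n (count-≤ (P ∘ suc))

count-pos : (P : Fin n → Bool) {i : Fin n} → P i ≡ true → 0 < count P
count-pos P {zero}  Pi rewrite Pi = s≤s z≤n
count-pos P {suc i} Pi = ≤-trans (count-pos (P ∘ suc) Pi) (m≤n+m _ (𝟙 (P zero)))

count-witness : (P : Fin n → Bool) → 0 < count P → ∃ λ i → P i ≡ true
count-witness {suc n} P pos with P zero in e
... | true  = zero , e
... | false = let i , Pi = count-witness (P ∘ suc) pos in suc i , Pi

count-≥2 : (P : Fin n → Bool) {x y : Fin n} → P x ≡ true → P y ≡ true → x ≢ y → 2 ≤ count P
count-≥2 P {zero}  {zero}  _  _  x≢y = ⊥-elim (x≢y refl)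
count-≥2 P {zero}  {suc y} Px Py _   rewrite Px = s≤s (count-pos (P ∘ suc) Py)
count-≥2 P {suc x} {zero}  Px Py _   rewrite Py = s≤s (count-pos (P ∘ suc) Px)
count-≥2 P {suc x} {suc y} Px Py x≢y =
  ≤-trans (count-≥2 (P ∘ suc) Px Py (x≢y ∘ cong suc)) (m≤n+m _ (𝟙 (P zero)))

count≡1⇒unique : (P : Fin n → Bool) → count P ≡ 1 → ∀ {x y} → P x ≡ true → P y ≡ true → x ≡ y
count≡1⇒unique P |P|≡1 {x} {y} Px Py with x ≟ y
... | yes x≡y = x≡y
... | no  x≢y = ⊥-elim (<⇒≱ (s≤s (s≤s z≤n)) (subst (2 ≤_) |P|≡1 (count-≥2 P Px Py x≢y)))

count-≥2⇒∃≢ : (P : Fin n → Bool) → 2 ≤ count P → (v : Fin n) → ∃ λ y → P y ≡ true × y ≢ v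
count-≥2⇒∃≢ {suc n} P two v with P zero in e | v
... | true  | zero  = let i , Pi = count-witness (P ∘ suc) (s≤s⁻¹ two) in suc i , Pi , λ ()
... | true  | suc _ = zero , e , λ ()
... | false | zero  = let i , Pi = count-witness (P ∘ suc) (≤-trans (s≤s z≤n) two) in suc i , Pi , λ ()
... | false | suc v = let y , Py , y≢v = count-≥2⇒∃≢ (P ∘ suc) two v in suc y , Py , y≢v ∘ suc-injective

count-∨ : (P Q : Fin n → Bool) → (∀ i → P i ∧ Q i ≡ false) →
          count (λ i → P i ∨ Q i) ≡ count P + count Q
count-∨ P Q disjoint = begin
  count (λ i → P i ∨ Q i)         ≡⟨ count≡sum (λ i → P i ∨ Q i) ⟩
  sum (λ i → 𝟙 (P i ∨ Q i))       ≡⟨ sum-cong-≗ (λ i → 𝟙-∨ (P i) (Q i) (disjoint i)) ⟩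
  sum (λ i → 𝟙 (P i) + 𝟙 (Q i))   ≡⟨ ∑-distrib-+ (𝟙 ∘ P) (𝟙 ∘ Q) ⟩
  sum (𝟙 ∘ P) + sum (𝟙 ∘ Q)       ≡⟨ cong₂ _+_ (count≡sum P) (count≡sum Q) ⟨
  count P + count Q               ∎
  where open ≡-Reasoning

count-partition : (Q P : Fin n → Bool) →
                  count P ≡ count (λ i → Q i ∧ P i) + count (λ i → not (Q i) ∧ P i)
count-partition Q P = trans (count-cong split) (count-∨ _ _ disjoint)
  where
  split : ∀ i → P i ≡ (Q i ∧ P i) ∨ (not (Q i) ∧ P i)
  split i with Q i
  ... | true  = ≡.sym (∨-identityʳ (P i))
  ... | false = refl
  disjoint : ∀ i → (Q i ∧ P i) ∧ (not (Q i) ∧ P i) ≡ false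
  disjoint i with Q i
  ... | true  = ∧-zeroʳ (P i)
  ... | false = refl

count-< : (P Q : Fin n → Bool) → (∀ i → P i ≡ true → Q i ≡ true) →
          ∀ {j} → Q j ≡ true → P j ≡ false → count P < count Q
count-< P Q P⊆Q {j} Qj ¬Pj = begin-strict
  count P                                               ≡⟨ count-cong P≡P∧Q ⟩
  count (λ i → P i ∧ Q i)                               <⟨ m<m+n _ (count-pos _ {j} ¬Pj∧Qj) ⟩
  count (λ i → P i ∧ Q i) + count (λ i → not (P i) ∧ Q i) ≡⟨ count-partition P Q ⟨
  count Q                                               ∎
  where
  open ≤-Reasoning
  P≡P∧Q : ∀ i → P i ≡ P i ∧ Q i
  P≡P∧Q i with P i in Pi
  ... | true  = ≡.sym (P⊆Q i Pi)
  ... | false = refl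
  ¬Pj∧Qj : not (P j) ∧ Q j ≡ true
  ¬Pj∧Qj = cong₂ (λ a b → not a ∧ b) ¬Pj Qj

sumOver : (Fin n → Bool) → (Fin n → ℕ) → ℕ
sumOver Z f = sum λ i → if Z i then f i else 0

sumOver-elem : (Z : Fin n → Bool) (f : Fin n → ℕ) {i : Fin n} → Z i ≡ true → f i ≤ sumOver Z f
sumOver-elem Z f {i} Zi = subst (λ b → (if b then f i else 0) ≤ sumOver Z f) Zi (≤-sum _ i)

sumOver-lower : (Z : Fin n → Bool) (f : Fin n → ℕ) {m : ℕ} →
                (∀ i → Z i ≡ true → m ≤ f i) → count Z * m ≤ sumOver Z f
sumOver-lower {zero}  Z f _ = z≤n
sumOver-lower {suc n} Z f m≤f with Z zero in Z₀
... | true  = +-mono-≤ (m≤f zero Z₀) (sumOver-lower (Z ∘ suc) (f ∘ suc) (m≤f ∘ suc))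
... | false = sumOver-lower (Z ∘ suc) (f ∘ suc) (m≤f ∘ suc)

sumOver-ones : (Z : Fin n → Bool) (f : Fin n → ℕ) → (∀ i → Z i ≡ true → f i ≡ 1) →
               sumOver Z f ≡ count Z
sumOver-ones {zero}  Z f _ = refl
sumOver-ones {suc n} Z f f≡1 with Z zero in Z₀
... | true  = cong₂ _+_ (f≡1 zero Z₀) (sumOver-ones (Z ∘ suc) (f ∘ suc) (f≡1 ∘ suc))
... | false = sumOver-ones (Z ∘ suc) (f ∘ suc) (f≡1 ∘ suc)

sumOver-tight : (Z : Fin n → Bool) (f : Fin n → ℕ) → (∀ i → Z i ≡ true → 1 ≤ f i) →
                sumOver Z f ≤ count Z → ∀ i → Z i ≡ true → f i ≡ 1
sumOver-tight {suc n} Z f 1≤f tight zero Zi rewrite Zi =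
  ≤-antisym (+-cancelʳ-≤ _ _ _ (≤-trans tight (+-monoʳ-≤ 1 rest-lower))) (1≤f zero Zi)
  where
  rest-lower : count (Z ∘ suc) ≤ sumOver (Z ∘ suc) (f ∘ suc)
  rest-lower = subst (_≤ sumOver (Z ∘ suc) (f ∘ suc)) (*-identityʳ _)
                     (sumOver-lower (Z ∘ suc) (f ∘ suc) (1≤f ∘ suc))
sumOver-tight {suc n} Z f 1≤f tight (suc j) Zj with Z zero in Z₀
... | true  = sumOver-tight (Z ∘ suc) (f ∘ suc) (1≤f ∘ suc)
                (+-cancelˡ-≤ 1 _ _ (≤-trans (+-monoˡ-≤ _ (1≤f zero Z₀)) tight)) j Zj
... | false = sumOver-tight (Z ∘ suc) (f ∘ suc) (1≤f ∘ suc) tight j Zj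

pairs : (Fin n → Fin n → Bool) → ℕ
pairs R = sum λ x → count (R x)

pairs-cong : {R S : Fin n → Fin n → Bool} → (∀ x y → R x y ≡ S x y) → pairs R ≡ pairs S
pairs-cong R≗S = sum-cong-≗ λ x → count-cong (R≗S x)

pairs-∨ : (R S : Fin n → Fin n → Bool) → (∀ x y → R x y ∧ S x y ≡ false) →
          pairs (λ x y → R x y ∨ S x y) ≡ pairs R + pairs S
pairs-∨ R S disjoint =
  trans (sum-cong-≗ λ x → count-∨ (R x) (S x) (disjoint x))
        (∑-distrib-+ (λ x → count (R x)) (λ x → count (S x)))

pairs-partition : (Q R : Fin n → Fin n → Bool) →
                  pairs R ≡ pairs (λ x y → Q x y ∧ R x y) + pairs (λ x y → not (Q x y) ∧ R x y)
pairs-partition Q R = trans (sum-cong-≗ λ x → count-partition (Q x) (R x))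
  (∑-distrib-+ (λ x → count (λ y → Q x y ∧ R x y)) (λ x → count (λ y → not (Q x y) ∧ R x y)))

pairs-transpose : (R : Fin n → Fin n → Bool) → pairs (λ x y → R y x) ≡ pairs R
pairs-transpose R = begin
  sum (λ x → count (λ y → R y x))     ≡⟨ sum-cong-≗ (λ x → count≡sum (λ y → R y x)) ⟩
  sum (λ x → sum (λ y → 𝟙 (R y x)))   ≡⟨ ∑-comm (λ x y → 𝟙 (R y x)) ⟩
  sum (λ y → sum (λ x → 𝟙 (R y x)))   ≡⟨ sum-cong-≗ (λ y → count≡sum (R y)) ⟨
  sum (λ y → count (R y))             ∎
  where open ≡-Reasoning

pairs≡0 : (R : Fin n → Fin n → Bool) → pairs R ≡ 0 → ∀ x y → R x y ≡ false
pairs≡0 R none x y with R x y in Rxy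
... | false = refl
... | true  = ⊥-elim (<⇒≱ (count-pos (R x) Rxy) (subst (count (R x) ≤_) none (≤-sum _ x)))

_<ᶠ_ : Fin n → Fin n → Bool
x <ᶠ y = toℕ x <ᵇ toℕ y

T⇒≡true : ∀ {b} → T b → b ≡ true
T⇒≡true = Equivalence.to T-≡

<ᶠ-asym : (x y : Fin n) → (x <ᶠ y) ∧ (y <ᶠ x) ≡ false
<ᶠ-asym x y with x <ᶠ y in x<y | y <ᶠ x in y<x
... | false | _     = refl
... | true  | false = refl
... | true  | true  = ⊥-elim (<-asym (<ᵇ⇒< (toℕ x) (toℕ y) (subst T (≡.sym x<y) tt))
                                     (<ᵇ⇒< (toℕ y) (toℕ x) (subst T (≡.sym y<x) tt)))

<ᶠ-connex : (x y : Fin n) → x ≢ y → (x <ᶠ y) ∨ (y <ᶠ x) ≡ true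
<ᶠ-connex x y x≢y with <-cmp (toℕ x) (toℕ y)
... | tri< x<y _ _ = cong (_∨ (y <ᶠ x)) (T⇒≡true (<⇒<ᵇ x<y))
... | tri≈ _ x≡y _ = ⊥-elim (x≢y (toℕ-injective x≡y))
... | tri> _ _ y<x = trans (cong ((x <ᶠ y) ∨_) (T⇒≡true (<⇒<ᵇ y<x))) (∨-zeroʳ _)

∧-disjointˡ : ∀ a b c d → a ∧ b ≡ false → (a ∧ c) ∧ (b ∧ d) ≡ false
∧-disjointˡ false b     c d _ = refl
∧-disjointˡ true  false c d _ = ∧-zeroʳ c

∧-disjointʳ : ∀ a b c d → c ∧ d ≡ false → (a ∧ c) ∧ (b ∧ d) ≡ false
∧-disjointʳ a b c d c∧d≡false = begin
  (a ∧ c) ∧ (b ∧ d) ≡⟨ cong₂ _∧_ (∧-comm a c) (∧-comm b d) ⟩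
  (c ∧ a) ∧ (d ∧ b) ≡⟨ ∧-disjointˡ c d a b c∧d≡false ⟩
  false             ∎
  where open ≡-Reasoning

pairs-symmetrize : (R : Fin n → Fin n → Bool) → (∀ x y → R x y ∧ R y x ≡ false) →
                   pairs (λ x y → (R x y ∨ R y x) ∧ x <ᶠ y) ≡ pairs R
pairs-symmetrize R antisym = begin
  pairs (λ x y → (R x y ∨ R y x) ∧ x <ᶠ y)
    ≡⟨ pairs-cong (λ x y → ∧-distribʳ-∨ (x <ᶠ y) (R x y) (R y x)) ⟩
  pairs (λ x y → (R x y ∧ x <ᶠ y) ∨ (R y x ∧ x <ᶠ y))
    ≡⟨ pairs-∨ _ _ (λ x y → ∧-disjointˡ (R x y) (R y x) (x <ᶠ y) (x <ᶠ y) (antisym x y)) ⟩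
  pairs (λ x y → R x y ∧ x <ᶠ y) + pairs (λ x y → R y x ∧ x <ᶠ y)
    ≡⟨ cong (pairs (λ x y → R x y ∧ x <ᶠ y) +_) (pairs-transpose (λ x y → R x y ∧ y <ᶠ x)) ⟩
  pairs (λ x y → R x y ∧ x <ᶠ y) + pairs (λ x y → R x y ∧ y <ᶠ x)
    ≡⟨ pairs-∨ _ _ (λ x y → ∧-disjointʳ (R x y) (R x y) (x <ᶠ y) (y <ᶠ x) (<ᶠ-asym x y)) ⟨
  pairs (λ x y → (R x y ∧ x <ᶠ y) ∨ (R x y ∧ y <ᶠ x))
    ≡⟨ pairs-cong oriented ⟩
  pairs R
    ∎
  where
  open ≡-Reasoning
  oriented : ∀ x y → (R x y ∧ x <ᶠ y) ∨ (R x y ∧ y <ᶠ x) ≡ R x y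
  oriented x y with R x y in Rxy
  ... | false = refl
  ... | true  = <ᶠ-connex x y λ { refl → not-¬ (cong₂ _∧_ Rxy Rxy) (antisym x x) }

-- Reachability

anyᵇ : (Fin n → Bool) → Bool
anyᵇ P = does (any? λ i → P i ≟ᵇ true)

anyᵇ-intro : (P : Fin n → Bool) {i : Fin n} → P i ≡ true → anyᵇ P ≡ true
anyᵇ-intro P {i} Pi = dec-true (any? λ i → P i ≟ᵇ true) (i , Pi)

anyᵇ-elim : (P : Fin n → Bool) → anyᵇ P ≡ true → ∃ λ i → P i ≡ true
anyᵇ-elim P some with any? (λ i → P i ≟ᵇ true)
anyᵇ-elim P _  | yes witness = witness
anyᵇ-elim P () | no _

Reach-snoc : {E : Fin n → Fin n → Bool} {x y z : Fin n} → Reach E x y → E y z ≡ true → Reach E x z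
Reach-snoc here        Eyz = step Eyz here
Reach-snoc (step Exw r) Eyz = step Exw (Reach-snoc r Eyz)

record ReachableSet (E : Fin n → Fin n → Bool) (u : Fin n) : Set where
  field
    set     : Fin n → Bool
    center  : set u ≡ true
    reached : ∀ {y} → set y ≡ true → Reach E u y
    closed  : ∀ {x y} → set x ≡ true → E x y ≡ true → set y ≡ true

-- The balls around u grow strictly until they are closed, and they cannot grow past n.
reachableSet : (E : Fin n → Fin n → Bool) (u : Fin n) → ReachableSet E u
reachableSet {n} E u = record
  { set = ball n ; center = ball-center n ; reached = ball-reached n ; closed = ball-closed }
  where
  ball : ℕ → Fin n → Bool
  ball zero    y = does (y ≟ u)
  ball (suc k) y = ball k y ∨ anyᵇ (λ x → ball k x ∧ E x y)

  ball-center : ∀ k → ball k u ≡ true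
  ball-center zero    = dec-true (u ≟ u) refl
  ball-center (suc k) = cong (_∨ anyᵇ (λ x → ball k x ∧ E x u)) (ball-center k)

  ball-mono : ∀ k {y} → ball k y ≡ true → ball (suc k) y ≡ true
  ball-mono k {y} y∈ = cong (_∨ anyᵇ (λ x → ball k x ∧ E x y)) y∈

  ball-reached : ∀ k {y} → ball k y ≡ true → Reach E u y
  ball-reached zero {y} y∈ with y ≟ u
  ... | yes refl = here
  ball-reached (suc k) {y} y∈ with ∨-true⇒ {ball k y} y∈
  ... | inj₁ y∈ₖ = ball-reached k y∈ₖ
  ... | inj₂ some with anyᵇ-elim (λ x → ball k x ∧ E x y) some
  ...   | x , x∈∧Exy = let x∈ , Exy = ∧-true⇒ {ball k x} x∈∧Exy in Reach-snoc (ball-reached k x∈) Exy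

  Closed : ℕ → Set
  Closed k = ∀ {x y} → ball k x ≡ true → E x y ≡ true → ball k y ≡ true

  ball-step : ∀ k {x y} → ball k x ≡ true → E x y ≡ true → ball (suc k) y ≡ true
  ball-step k {x} {y} x∈ Exy =
    trans (cong (ball k y ∨_) (anyᵇ-intro (λ x → ball k x ∧ E x y) (cong₂ _∧_ x∈ Exy))) (∨-zeroʳ _)

  closed-stable : ∀ k → Closed k → ∀ {y} → ball (suc k) y ≡ true → ball k y ≡ true
  closed-stable k closedₖ {y} y∈ with ∨-true⇒ {ball k y} y∈
  ... | inj₁ y∈ₖ = y∈ₖ
  ... | inj₂ some with anyᵇ-elim (λ x → ball k x ∧ E x y) some
  ...   | x , x∈∧Exy = let x∈ , Exy = ∧-true⇒ {ball k x} x∈∧Exy in closedₖ x∈ Exy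

  closed-suc : ∀ k → Closed k → Closed (suc k)
  closed-suc k closedₖ x∈ Exy = ball-mono k (closedₖ (closed-stable k closedₖ x∈) Exy)

  ball-grows : ∀ k → Closed k ⊎ k < count (ball k)
  ball-grows zero = inj₂ (count-pos (ball zero) {u} (ball-center zero))
  ball-grows (suc k) with ball-grows k
  ... | inj₁ closedₖ = inj₁ (closed-suc k closedₖ)
  ... | inj₂ k<|ball| with count (ball k) <? count (ball (suc k))
  ...   | yes grew  = inj₂ (≤-<-trans k<|ball| grew)
  ...   | no  ¬grew = inj₁ (closed-suc k (λ x∈ Exy → stays (ball-step k x∈ Exy)))
    where
    stays : ∀ {y} → ball (suc k) y ≡ true → ball k y ≡ true
    stays {y} y∈ with ball k y ≟ᵇ true
    ... | yes y∈ₖ = y∈ₖ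
    ... | no  y∉ₖ = ⊥-elim (¬grew (count-< (ball k) (ball (suc k)) (λ _ → ball-mono k) y∈ (¬-not y∉ₖ)))

  ball-closed : Closed n
  ball-closed with ball-grows n
  ... | inj₁ closedₙ = closedₙ
  ... | inj₂ n<|ball| = ⊥-elim (<⇒≱ n<|ball| (count-≤ (ball n)))

degIn degOut : Graph n → (Fin n → Bool) → Fin n → ℕ
degIn  G Z x = count λ y → Z y ∧ adj G x y
degOut G Z x = count λ y → not (Z y) ∧ adj G x y

deg-split : (G : Graph n) (Z : Fin n → Bool) (x : Fin n) → deg G x ≡ degIn G Z x + degOut G Z x
deg-split G Z x = count-partition Z (adj G x)

count-nonNbrs : (G : Graph n) (Z : Fin n → Bool) (x : Fin n) →
                count Z ≡ degIn G Z x + count (λ y → not (adj G x y) ∧ Z y)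
count-nonNbrs G Z x =
  trans (count-partition (adj G x) Z)
        (cong (_+ count (λ y → not (adj G x y) ∧ Z y)) (count-cong λ y → ∧-comm (adj G x y) (Z y)))

degIn<count : (G : Graph n) (Z : Fin n → Bool) {x : Fin n} → Z x ≡ true → degIn G Z x < count Z
degIn<count G Z {x} Zx = begin-strict
  degIn G Z x                                            <⟨ m<m+n _ (count-pos _ {x} x-nonNbr) ⟩
  degIn G Z x + count (λ y → not (adj G x y) ∧ Z y)      ≡⟨ count-nonNbrs G Z x ⟨
  count Z                                                ∎
  where
  open ≤-Reasoning
  x-nonNbr : not (adj G x x) ∧ Z x ≡ true
  x-nonNbr = cong₂ (λ a b → not a ∧ b) (irrefl G x) Zx

Expanding : Graph n → (Fin n → Bool) → Set
Expanding G Z = ∀ x → Z x ≡ true → 0 < degOut G Z x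

Separates : (G : Graph n) → EdgeSet G → (Fin n → Bool) → Set
Separates G F Z = ∀ x y → Z x ≡ true → Z y ≡ false → adj G x y ≡ true → mem F x y ≡ true

separates-complement : {G : Graph n} {F : EdgeSet G} {Z : Fin n → Bool} →
                       Separates G F Z → Separates G F (not ∘ Z)
separates-complement {G = G} {F} sep x y ¬Zx ¬Zy Gxy =
  trans (memSym F x y) (sep y x (not-injective ¬Zy) (not-injective ¬Zx) (trans (Graph.sym G y x) Gxy))

remove-mem : {G : Graph n} {F : EdgeSet G} {x y : Fin n} → mem F x y ≡ true → remove G F x y ≡ false
remove-mem {G = G} {x = x} {y} x∈F = trans (cong (λ b → adj G x y ∧ not b) x∈F) (∧-zeroʳ _)

separates-closed : {G : Graph n} {F : EdgeSet G} {Z : Fin n → Bool} → Separates G F Z →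
                   ∀ {x y} → Reach (remove G F) x y → Z x ≡ true → Z y ≡ true
separates-closed sep here Zx = Zx
separates-closed {G = G} {F} {Z} sep (step {u} {w} e r) Zu with Z w in Zw
... | true  = separates-closed {G = G} {F} {Z} sep r Zw
... | false = ⊥-elim (not-¬ e (remove-mem {G = G} {F = F} (sep u w Zu Zw (proj₁ (∧-true⇒ e)))))

_⊆ᴱ_ : {G : Graph n} → EdgeSet G → EdgeSet G → Set
F₁ ⊆ᴱ F₂ = ∀ x y → mem F₁ x y ≡ true → mem F₂ x y ≡ true

size-⊆ : {G : Graph n} {F₁ F₂ : EdgeSet G} → F₁ ⊆ᴱ F₂ →
         size F₂ ≡ size F₁ + pairs (λ x y → not (mem F₁ x y) ∧ (mem F₂ x y ∧ x <ᶠ y))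
size-⊆ {F₁ = F₁} {F₂} F₁⊆F₂ =
  trans (pairs-partition (mem F₁) (λ x y → mem F₂ x y ∧ x <ᶠ y))
        (cong (_+ pairs (λ x y → not (mem F₁ x y) ∧ (mem F₂ x y ∧ x <ᶠ y))) (pairs-cong both))
  where
  both : ∀ x y → mem F₁ x y ∧ (mem F₂ x y ∧ x <ᶠ y) ≡ mem F₁ x y ∧ x <ᶠ y
  both x y with mem F₁ x y in x∈F₁
  ... | false = refl
  ... | true  = cong (_∧ x <ᶠ y) (F₁⊆F₂ x y x∈F₁)

size-mono : {G : Graph n} {F₁ F₂ : EdgeSet G} → F₁ ⊆ᴱ F₂ → size F₁ ≤ size F₂
size-mono {G = G} {F₁} {F₂} F₁⊆F₂ =
  subst (size F₁ ≤_) (≡.sym (size-⊆ {G = G} {F₁} {F₂} F₁⊆F₂)) (m≤m+n _ _)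

size-⊆-equal : {G : Graph n} {F₁ F₂ : EdgeSet G} → F₁ ⊆ᴱ F₂ → size F₂ ≤ size F₁ → F₂ ⊆ᴱ F₁
size-⊆-equal {n = n} {G = G} {F₁} {F₂} F₁⊆F₂ |F₂|≤|F₁| x y x∈F₂ =
  [ ascending x y x∈F₂
  , (λ y<x → trans (memSym F₁ x y) (ascending y x (trans (memSym F₂ y x) x∈F₂) y<x))
  ]′ (∨-true⇒ (<ᶠ-connex x y x≢y))
  where
  x≢y : x ≢ y
  x≢y refl = not-¬ (memSub F₂ x x x∈F₂) (irrefl G x)
  rest : Fin n → Fin n → Bool
  rest x y = not (mem F₁ x y) ∧ (mem F₂ x y ∧ x <ᶠ y)
  no-rest : pairs rest ≡ 0
  no-rest = n≤0⇒n≡0 (+-cancelˡ-≤ (size F₁) (pairs rest) 0 (begin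
    size F₁ + pairs rest ≡⟨ size-⊆ {G = G} {F₁} {F₂} F₁⊆F₂ ⟨
    size F₂              ≤⟨ |F₂|≤|F₁| ⟩
    size F₁              ≡⟨ +-identityʳ (size F₁) ⟨
    size F₁ + 0          ∎))
    where open ≤-Reasoning
  ascending : ∀ x y → mem F₂ x y ≡ true → x <ᶠ y ≡ true → mem F₁ x y ≡ true
  ascending x y x∈F₂ x<y = not-injective (begin
    not (mem F₁ x y)                         ≡⟨ ∧-identityʳ _ ⟨
    not (mem F₁ x y) ∧ true                  ≡⟨ cong₂ (λ a b → not (mem F₁ x y) ∧ (a ∧ b)) x∈F₂ x<y ⟨
    not (mem F₁ x y) ∧ (mem F₂ x y ∧ x <ᶠ y) ≡⟨ pairs≡0 rest no-rest x y ⟩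
    false                                    ∎)
    where open ≡-Reasoning

leaves : Graph n → (Fin n → Bool) → Fin n → Fin n → Bool
leaves G Z x y = (Z x ∧ not (Z y)) ∧ adj G x y

leaves-elim : (G : Graph n) (Z : Fin n → Bool) {x y : Fin n} →
              leaves G Z x y ≡ true → Z x ≡ true × Z y ≡ false × adj G x y ≡ true
leaves-elim G Z {x} {y} e with ∧-true⇒ {Z x ∧ not (Z y)} e
... | Zx∧¬Zy , Gxy with ∧-true⇒ {Z x} Zx∧¬Zy
...   | Zx , ¬Zy = Zx , not-injective ¬Zy , Gxy

boundary : (G : Graph n) → (Fin n → Bool) → EdgeSet G
boundary G Z = record
  { mem    = λ x y → leaves G Z x y ∨ leaves G Z y x
  ; memSym = λ x y → ∨-comm (leaves G Z x y) (leaves G Z y x)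
  ; memSub = sub
  }
  where
  sub : ∀ x y → leaves G Z x y ∨ leaves G Z y x ≡ true → adj G x y ≡ true
  sub x y e with ∨-true⇒ {leaves G Z x y} e
  ... | inj₁ out = proj₂ (proj₂ (leaves-elim G Z out))
  ... | inj₂ in′ = trans (Graph.sym G x y) (proj₂ (proj₂ (leaves-elim G Z in′)))

boundary-separates : (G : Graph n) (Z : Fin n → Bool) → Separates G (boundary G Z) Z
boundary-separates G Z x y Zx Zy Gxy =
  cong (_∨ leaves G Z y x) (trans (cong₂ (λ a b → (a ∧ not b) ∧ adj G x y) Zx Zy) Gxy)

boundary-inside : (G : Graph n) (Z : Fin n → Bool) {x y : Fin n} {b : Bool} →
                  Z x ≡ b → Z y ≡ b → mem (boundary G Z) x y ≡ false
boundary-inside G Z {x} {y} {true}  = cong₂ λ a c → ((a ∧ not c) ∧ adj G x y) ∨ ((c ∧ not a) ∧ adj G y x)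
boundary-inside G Z {x} {y} {false} = cong₂ λ a c → ((a ∧ not c) ∧ adj G x y) ∨ ((c ∧ not a) ∧ adj G y x)

boundary-touches : (G : Graph n) (Z : Fin n → Bool) {x y : Fin n} →
                   mem (boundary G Z) x y ≡ true → Z x ≡ true ⊎ Z y ≡ true
boundary-touches G Z {x} e =
  Data.Sum.map (proj₁ ∘ leaves-elim G Z) (proj₁ ∘ leaves-elim G Z) (∨-true⇒ {leaves G Z x _} e)

separates⇒boundary⊆ : {G : Graph n} {F : EdgeSet G} {Z : Fin n → Bool} →
                       Separates G F Z → boundary G Z ⊆ᴱ F
separates⇒boundary⊆ {G = G} {F} {Z} sep x y e with ∨-true⇒ {leaves G Z x y} e
... | inj₁ out = let Zx , ¬Zy , Gxy = leaves-elim G Z out in sep x y Zx ¬Zy Gxy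
... | inj₂ in′ = let Zy , ¬Zx , Gyx = leaves-elim G Z in′ in trans (memSym F x y) (sep y x Zy ¬Zx Gyx)

size-boundary : (G : Graph n) (Z : Fin n → Bool) → size (boundary G Z) ≡ sumOver Z (degOut G Z)
size-boundary {n} G Z = trans (pairs-symmetrize (leaves G Z) one-way) (sum-cong-≗ row)
  where
  one-way : ∀ x y → ((Z x ∧ not (Z y)) ∧ adj G x y) ∧ ((Z y ∧ not (Z x)) ∧ adj G y x) ≡ false
  one-way x y with Z x | Z y
  ... | true  | true  = refl
  ... | true  | false = ∧-zeroʳ (adj G x y)
  ... | false | _     = refl
  row : ∀ x → count (λ y → (Z x ∧ not (Z y)) ∧ adj G x y) ≡ (if Z x then degOut G Z x else 0)
  row x with Z x
  ... | true  = refl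
  ... | false = count-false n

isStar⇒touches : {G : Graph n} {F : EdgeSet G} {v : Fin n} → IsStar G F v →
                 ∀ {x y} → mem F x y ≡ true → x ≡ v ⊎ y ≡ v
isStar⇒touches {G = G} {F} {v} star {x} {y} x∈F with x ≟ v | y ≟ v | trans (≡.sym x∈F) (star x y)
... | yes x≡v | _       | _ = inj₁ x≡v
... | no _    | yes y≡v | _ = inj₂ y≡v
... | no _    | no _    | e = ⊥-elim (not-¬ (≡.sym e) (∧-zeroʳ (adj G x y)))

isStar⇒incident : {G : Graph n} {F : EdgeSet G} {v : Fin n} → IsStar G F v →
                  ∀ {y} → adj G v y ≡ true → mem F v y ≡ true
isStar⇒incident {G = G} {F} {v} star {y} Gvy =
  trans (star v y) (cong₂ (λ a b → a ∧ (b ∨ does (y ≟ v))) Gvy (dec-true (v ≟ v) refl))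

isStar-intro : {G : Graph n} {F : EdgeSet G} {v : Fin n} →
               (∀ x y → mem F x y ≡ true → x ≡ v ⊎ y ≡ v) →
               (∀ y → adj G v y ≡ true → mem F v y ≡ true) → IsStar G F v
isStar-intro {G = G} {F} {v} touches incident = star
  where
  non-incident : ∀ {y} → mem F v y ≡ false → adj G v y ≡ false
  non-incident {y} v∉F = ¬-not λ Gvy → not-¬ (incident y Gvy) v∉F
  star : IsStar G F v
  star x y with mem F x y in x∈F | x ≟ v | y ≟ v
  ... | true  | yes _    | _        = ≡.sym (trans (∧-identityʳ _) (memSub F x y x∈F))
  ... | true  | no _     | yes _    = ≡.sym (trans (∧-identityʳ _) (memSub F x y x∈F))
  ... | true  | no x≢v   | no y≢v   = ⊥-elim ([ x≢v , y≢v ]′ (touches x y x∈F))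
  ... | false | no _     | no _     = ≡.sym (∧-zeroʳ (adj G x y))
  ... | false | yes refl | _        = ≡.sym (trans (∧-identityʳ _) (non-incident x∈F))
  ... | false | no _     | yes refl =
    ≡.sym (trans (∧-identityʳ _) (trans (Graph.sym G x v) (non-incident (trans (memSym F v x) x∈F))))

-- The two sides of a cut of size δ

m+n≤m*n : ∀ {m n} → 2 ≤ m → 2 ≤ n → m + n ≤ m * n
m+n≤m*n {suc m@(suc _)} {n} (s≤s (s≤s _)) 2≤n = begin
  suc m + n   ≡⟨ +-comm (suc m) n ⟩
  n + suc m   ≤⟨ +-monoʳ-≤ n (m<m*n m n 2≤n) ⟩
  n + m * n   ∎
  where open ≤-Reasoning

record TightSide (G : Graph n) (δ : ℕ) (X : Fin n → Bool) : Set where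
  field
    count≡δ  : count X ≡ δ
    clique   : ∀ x y → X x ≡ true → X y ≡ true → x ≢ y → adj G x y ≡ true
    degOut≡1 : ∀ x → X x ≡ true → degOut G X x ≡ 1

module _ {n : ℕ} {G : Graph n} {F : EdgeSet G} {δ : ℕ}
         (|F|≡δ : size F ≡ δ) (minDeg : ∀ v → δ ≤ deg G v) where

  boundary≤δ : {Z : Fin n → Bool} → Separates G F Z → sumOver Z (degOut G Z) ≤ δ
  boundary≤δ {Z} sep = begin
    sumOver Z (degOut G Z)  ≡⟨ size-boundary G Z ⟨
    size (boundary G Z)     ≤⟨ size-mono {G = G} {boundary G Z} {F} (separates⇒boundary⊆ {G = G} {F} {Z} sep) ⟩
    size F                  ≡⟨ |F|≡δ ⟩
    δ                       ∎
    where open ≤-Reasoning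

  δ<count+degOut : {Z : Fin n → Bool} {x : Fin n} → Z x ≡ true → δ < count Z + degOut G Z x
  δ<count+degOut {Z} {x} Zx = begin-strict
    δ                          ≤⟨ minDeg x ⟩
    deg G x                    ≡⟨ deg-split G Z x ⟩
    degIn G Z x + degOut G Z x <⟨ +-monoˡ-< (degOut G Z x) (degIn<count G Z Zx) ⟩
    count Z + degOut G Z x     ∎
    where open ≤-Reasoning

  no-small-separated-set : {Z : Fin n → Bool} → Separates G F Z → 2 ≤ count Z → ¬ (count Z < δ)
  no-small-separated-set {Z} sep 2≤|Z| |Z|<δ with m≤n⇒∃[o]m+o≡n |Z|<δ
  ... | e , 1+|Z|+e≡δ = <⇒≱ δ<boundary (boundary≤δ {Z} sep)
    where
    open ≤-Reasoning
    δ≡ : δ ≡ count Z + suc e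
    δ≡ = trans (≡.sym 1+|Z|+e≡δ) (≡.sym (+-suc (count Z) e))
    many-out : ∀ x → Z x ≡ true → 2 + e ≤ degOut G Z x
    many-out x Zx = +-cancelˡ-< (count Z) (suc e) (degOut G Z x)
                      (subst (_< count Z + degOut G Z x) δ≡ (δ<count+degOut {Z} {x} Zx))
    δ<boundary : δ < sumOver Z (degOut G Z)
    δ<boundary = begin-strict
      δ                       ≡⟨ δ≡ ⟩
      count Z + suc e         <⟨ +-monoʳ-< (count Z) (n<1+n (suc e)) ⟩
      count Z + (2 + e)       ≤⟨ m+n≤m*n 2≤|Z| (s≤s (s≤s z≤n)) ⟩
      count Z * (2 + e)       ≤⟨ sumOver-lower Z (degOut G Z) many-out ⟩
      sumOver Z (degOut G Z)  ∎

  -- The at least δ edges at z all lie in F, and there are only δ edges in F.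
  singleton-separated⇒star : {Z : Fin n → Bool} {z : Fin n} →
                             Separates G F Z → count Z ≡ 1 → Z z ≡ true → IsStar G F z
  singleton-separated⇒star {Z} {z} sep |Z|≡1 Zz = isStar-intro {G = G} {F} touches incident
    where
    open ≤-Reasoning
    only-z : ∀ {y} → Z y ≡ true → y ≡ z
    only-z Zy = count≡1⇒unique Z |Z|≡1 Zy Zz
    degIn≡0 : degIn G Z z ≡ 0
    degIn≡0 = n<1⇒n≡0 (subst (degIn G Z z <_) |Z|≡1 (degIn<count G Z Zz))
    F≤boundary : size F ≤ size (boundary G Z)
    F≤boundary = begin
      size F                     ≡⟨ |F|≡δ ⟩
      δ                          ≤⟨ minDeg z ⟩
      deg G z                    ≡⟨ deg-split G Z z ⟩
      degIn G Z z + degOut G Z z ≡⟨ cong (_+ degOut G Z z) degIn≡0 ⟩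
      degOut G Z z               ≤⟨ sumOver-elem Z (degOut G Z) Zz ⟩
      sumOver Z (degOut G Z)     ≡⟨ size-boundary G Z ⟨
      size (boundary G Z)        ∎
    touches : ∀ x y → mem F x y ≡ true → x ≡ z ⊎ y ≡ z
    touches x y x∈F = Data.Sum.map only-z only-z (boundary-touches G Z
      (size-⊆-equal {G = G} {boundary G Z} {F} (separates⇒boundary⊆ {G = G} {F} {Z} sep) F≤boundary x y x∈F))
    incident : ∀ y → adj G z y ≡ true → mem F z y ≡ true
    incident y Gzy = sep z y Zz (¬-not λ Zy → not-¬ Gzy (irreflexive (only-z Zy))) Gzy
      where irreflexive : y ≡ z → adj G z y ≡ false
            irreflexive refl = irrefl G z

  separated-set-large : {Z : Fin n → Bool} {z : Fin n} → Separates G F Z → Z z ≡ true →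
                        ¬ (∃[ v ] IsStar G F v) → δ ≤ count Z
  separated-set-large {Z} {z} sep Zz no-star with δ ≤? count Z
  ... | yes δ≤|Z| = δ≤|Z|
  ... | no  δ≰|Z| with m≤n⇒m<n∨m≡n (count-pos Z Zz)
  ...   | inj₁ 2≤|Z| = ⊥-elim (no-small-separated-set sep 2≤|Z| (≰⇒> δ≰|Z|))
  ...   | inj₂ 1≡|Z| = ⊥-elim (no-star (z , singleton-separated⇒star sep (≡.sym 1≡|Z|) Zz))

  expanding-side-tight : {X : Fin n → Bool} → Separates G F X → Expanding G X → δ ≤ count X → TightSide G δ X
  expanding-side-tight {X} sep expanding δ≤|X| =
    record { count≡δ = |X|≡δ ; clique = clique ; degOut≡1 = degOut≡1 }
    where
    open ≤-Reasoning
    |X|≤boundary : count X ≤ sumOver X (degOut G X)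
    |X|≤boundary = subst (_≤ sumOver X (degOut G X)) (*-identityʳ (count X)) (sumOver-lower X (degOut G X) expanding)
    |X|≡δ : count X ≡ δ
    |X|≡δ = ≤-antisym (≤-trans |X|≤boundary (boundary≤δ sep)) δ≤|X|
    degOut≡1 : ∀ x → X x ≡ true → degOut G X x ≡ 1
    degOut≡1 = sumOver-tight X (degOut G X) expanding
                 (subst (sumOver X (degOut G X) ≤_) (≡.sym |X|≡δ) (boundary≤δ sep))
    -- a non-neighbour y ≠ x in X would leave x with fewer than δ neighbours
    clique : ∀ x y → X x ≡ true → X y ≡ true → x ≢ y → adj G x y ≡ true
    clique x y Xx Xy x≢y = ¬-not λ x≁y → <⇒≱ (too-few-nbrs x≁y) at-least-δ
      where
      at-least-δ : count X ≤ degIn G X x + 1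
      at-least-δ = begin
        count X                    ≡⟨ |X|≡δ ⟩
        δ                          ≤⟨ minDeg x ⟩
        deg G x                    ≡⟨ deg-split G X x ⟩
        degIn G X x + degOut G X x ≡⟨ cong (degIn G X x +_) (degOut≡1 x Xx) ⟩
        degIn G X x + 1            ∎
      too-few-nbrs : adj G x y ≡ false → degIn G X x + 1 < count X
      too-few-nbrs x≁y = begin-strict
        degIn G X x + 1                                  <⟨ +-monoʳ-< (degIn G X x) (count-≥2 _ x∉N y∉N x≢y) ⟩
        degIn G X x + count (λ w → not (adj G x w) ∧ X w) ≡⟨ count-nonNbrs G X x ⟨
        count X                                          ∎
        where
        x∉N : not (adj G x x) ∧ X x ≡ true
        x∉N = cong₂ (λ a b → not a ∧ b) (irrefl G x) Xx
        y∉N : not (adj G x y) ∧ X y ≡ true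
        y∉N = cong₂ (λ a b → not a ∧ b) x≁y Xy

-- If some x₀ ∈ Z has no neighbour outside Z, every vertex outside Z reaches x₀ through a neighbour in Z.
diam2-expanding : {G : Graph n} → DiamAtMost2 G → (Z : Fin n → Bool) → Expanding G Z ⊎ Expanding G (not ∘ Z)
diam2-expanding {G = G} diam Z with any? (λ x → (Z x ≟ᵇ true) ×-dec (degOut G Z x ℕ.≟ 0))
... | no  none-isolated = inj₁ λ x Zx → n≢0⇒n>0 λ d≡0 → none-isolated (x , Zx , d≡0)
... | yes (x₀ , Zx₀ , d≡0) = inj₂ λ y ¬Zy → nbr-in-Z y (not-injective ¬Zy)
  where
  isolated : ∀ w → not (Z w) ∧ adj G x₀ w ≡ true → ⊥
  isolated w e = <⇒≢ (count-pos (λ w → not (Z w) ∧ adj G x₀ w) e) (≡.sym d≡0)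
  nbr-in-Z : ∀ y → Z y ≡ false → 0 < degOut G (not ∘ Z) y
  nbr-in-Z y Zy with diam x₀ y (λ { refl → not-¬ Zx₀ Zy })
  ... | inj₁ Gx₀y = ⊥-elim (isolated y (cong₂ (λ a b → not a ∧ b) Zy Gx₀y))
  ... | inj₂ (w , Gx₀w , Gwy) with Z w in Zw
  ...   | false = ⊥-elim (isolated w (cong₂ (λ a b → not a ∧ b) Zw Gx₀w))
  ...   | true  = count-pos (λ w → not (not (Z w)) ∧ adj G y w)
                            (cong₂ (λ a b → not (not a) ∧ b) Zw (trans (Graph.sym G y w) Gwy))

-- The partition

classify : (inside nbrInside : Bool) → Part
classify true  _     = pA
classify false true  = pB
classify false false = pC

classify-pA : ∀ a b → classify a b ≡ pA → a ≡ true
classify-pA true  _     _  = refl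
classify-pA false true  ()
classify-pA false false ()

classify-pB : ∀ a b → classify a b ≡ pB → a ≡ false × b ≡ true
classify-pB true  _     ()
classify-pB false true  _  = refl , refl
classify-pB false false ()

classify-pC : ∀ a b → classify a b ≡ pC → a ≡ false × b ≡ false
classify-pC true  _     ()
classify-pC false true  ()
classify-pC false false _  = refl , refl

isA-classify : ∀ a b → isA (classify a b) ≡ a
isA-classify true  _     = refl
isA-classify false true  = refl
isA-classify false false = refl

isA⇒pA : ∀ p → isA p ≡ true → p ≡ pA
isA⇒pA pA _ = refl

isB⇒pB : ∀ p → isB p ≡ true → p ≡ pB
isB⇒pB pB _ = refl

sideLabel : Graph n → (Fin n → Bool) → Fin n → Part
sideLabel G X i = classify (X i) (anyᵇ λ w → X w ∧ adj G i w)

tightSide⇒goodPartition : {G : Graph n} {δ : ℕ} {X : Fin n → Bool} → DiamAtMost2 G → TightSide G δ X →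
                          δ ≤ count (not ∘ X) → GoodPartition G δ (sideLabel G X)
tightSide⇒goodPartition {n} {G} {δ} {X} diam tight δ≤|Xᶜ| =
  |A|≡δ , A-clique , δ≤|B∪C| , A-one-B , A-no-C , B-has-A , B-C-complete
  where
  open TightSide tight
  lab = sideLabel G X
  nbrInX : Fin n → Bool
  nbrInX i = anyᵇ λ w → X w ∧ adj G i w
  no-nbrInX : ∀ {v w} → nbrInX v ≡ false → X w ≡ true → adj G v w ≡ false
  no-nbrInX {v} ¬nbr Xw = ¬-not λ Gvw → not-¬ (anyᵇ-intro (λ w → X w ∧ adj G v w) (cong₂ _∧_ Xw Gvw)) ¬nbr

  |A|≡δ : count (λ v → isA (lab v)) ≡ δ
  |A|≡δ = trans (count-cong λ v → isA-classify (X v) (nbrInX v)) count≡δ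
  A-clique : ∀ u v → lab u ≡ pA → lab v ≡ pA → u ≢ v → adj G u v ≡ true
  A-clique u v lu lv = clique u v (classify-pA _ _ lu) (classify-pA _ _ lv)
  δ≤|B∪C| : δ ≤ count (λ v → not (isA (lab v)))
  δ≤|B∪C| = subst (δ ≤_) (count-cong λ v → cong not (≡.sym (isA-classify (X v) (nbrInX v)))) δ≤|Xᶜ|
  A-one-B : ∀ v → lab v ≡ pA → count (λ w → adj G v w ∧ isB (lab w)) ≡ 1
  A-one-B v lv = trans (count-cong B-nbr⇔outside) (degOut≡1 v Xv)
    where
    Xv = classify-pA _ _ lv
    B-nbr⇔outside : ∀ w → adj G v w ∧ isB (classify (X w) (nbrInX w)) ≡ not (X w) ∧ adj G v w
    B-nbr⇔outside w with X w | adj G v w in Gvw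
    ... | true  | a     = ∧-zeroʳ a
    ... | false | false = refl
    ... | false | true  = cong (isB ∘ classify false)
                              (anyᵇ-intro (λ u → X u ∧ adj G w u) (cong₂ _∧_ Xv (trans (Graph.sym G w v) Gvw)))
  A-no-C : ∀ v w → lab v ≡ pA → lab w ≡ pC → adj G v w ≡ false
  A-no-C v w lv lw = trans (Graph.sym G v w) (no-nbrInX (proj₂ (classify-pC _ _ lw)) (classify-pA _ _ lv))
  B-has-A : ∀ v → lab v ≡ pB → ∃[ w ] (lab w ≡ pA × adj G v w ≡ true)
  B-has-A v lv with anyᵇ-elim (λ w → X w ∧ adj G v w) (proj₂ (classify-pB _ _ lv))
  ... | w , Xw∧Gvw = let Xw , Gvw = ∧-true⇒ {X w} Xw∧Gvw in w , cong (λ a → classify a (nbrInX w)) Xw , Gvw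
  -- a common neighbour w of u's neighbour a ∈ X and of v lies outside X, so it is a's unique outside neighbour u
  B-C-complete : ∀ u v → lab u ≡ pB → lab v ≡ pC → adj G u v ≡ true
  B-C-complete u v lu lv with B-has-A u lu
  ... | a , la , Gua = via-common-nbr (diam a v a≢v)
    where
    Xa : X a ≡ true
    Xa = classify-pA _ _ la
    ¬Xv : X v ≡ false
    ¬Xv = proj₁ (classify-pC _ _ lv)
    ¬nbr-v : nbrInX v ≡ false
    ¬nbr-v = proj₂ (classify-pC _ _ lv)
    a≢v : a ≢ v
    a≢v refl = not-¬ Xa ¬Xv
    outside-nbr-of-a : ∀ {y} → X y ≡ false → adj G a y ≡ true → not (X y) ∧ adj G a y ≡ true
    outside-nbr-of-a = cong₂ (λ p q → not p ∧ q)
    via-common-nbr : adj G a v ≡ true ⊎ ∃[ w ] (adj G a w ≡ true × adj G w v ≡ true) → adj G u v ≡ true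
    via-common-nbr (inj₁ Gav) = ⊥-elim (not-¬ (trans (Graph.sym G v a) Gav) (no-nbrInX ¬nbr-v Xa))
    via-common-nbr (inj₂ (w , Gaw , Gwv)) = subst (λ x → adj G x v ≡ true) w≡u Gwv
      where
      ¬Xw : X w ≡ false
      ¬Xw = ¬-not λ Xw → not-¬ (trans (Graph.sym G v w) Gwv) (no-nbrInX ¬nbr-v Xw)
      w≡u : w ≡ u
      w≡u = count≡1⇒unique (λ y → not (X y) ∧ adj G a y) (degOut≡1 a Xa)
              (outside-nbr-of-a ¬Xw Gaw)
              (outside-nbr-of-a (proj₁ (classify-pB _ _ lu)) (trans (Graph.sym G a u) Gua))

cut⇒goodPartition : {G : Graph n} {δ : ℕ} → DiamAtMost2 G → (∀ v → δ ≤ deg G v) →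
                    ∃[ F ] (IsEdgeCut G F × size F ≡ δ × ¬ (∃[ v ] IsStar G F v)) →
                    ∃[ lab ] GoodPartition G δ lab
cut⇒goodPartition {n} {G} {δ} diam minDeg (F , (u , v , u↛v) , |F|≡δ , no-star) =
  [ from-side S sepS Su Sv
  , from-side (not ∘ S) (separates-complement {G = G} {F} {S} sepS) (cong not Sv) (cong not Su)
  ]′ (diam2-expanding {G = G} diam S)
  where
  open ReachableSet (reachableSet (remove G F) u) renaming (set to S; center to Su)
  Sv : S v ≡ false
  Sv = ¬-not (u↛v ∘ reached)
  sepS : Separates G F S
  sepS x y Sx Sy Gxy = ¬-not λ x∉F → not-¬ (closed Sx (cong₂ (λ a b → a ∧ not b) Gxy x∉F)) Sy
  from-side : (X : Fin n → Bool) {a b : Fin n} → Separates G F X → X a ≡ true → X b ≡ false →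
              Expanding G X → ∃[ lab ] GoodPartition G δ lab
  from-side X sep Xa Xb expanding = sideLabel G X , tightSide⇒goodPartition diam
    (expanding-side-tight {F = F} |F|≡δ minDeg {X} sep expanding
      (separated-set-large {F = F} |F|≡δ minDeg {X} sep Xa no-star))
    (separated-set-large {F = F} |F|≡δ minDeg {not ∘ X}
      (separates-complement {G = G} {F} {X} sep) (cong not Xb) no-star)

A-boundary-isCut : {G : Graph n} {δ : ℕ} {lab : Fin n → Part} → 1 ≤ δ → GoodPartition G δ lab →
                   IsEdgeCut G (boundary G (isA ∘ lab))
A-boundary-isCut {G = G} {lab = lab} 1≤δ (|A|≡δ , _ , δ≤|B∪C| , _)
  with count-witness (isA ∘ lab) (subst (1 ≤_) (≡.sym |A|≡δ) 1≤δ)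
     | count-witness (not ∘ isA ∘ lab) (≤-trans 1≤δ δ≤|B∪C|)
... | a , Aa | y , ¬Ay = a , y , λ a↝y →
  not-¬ (separates-closed {G = G} {boundary G A} {A} (boundary-separates G A) a↝y Aa) (not-injective ¬Ay)
  where A = isA ∘ lab

size-A-boundary : {G : Graph n} {δ : ℕ} {lab : Fin n → Part} → GoodPartition G δ lab →
                  size (boundary G (isA ∘ lab)) ≡ δ
size-A-boundary {G = G} {δ} {lab} (|A|≡δ , _ , _ , A-one-B , A-no-C , _) = begin
  size (boundary G A)    ≡⟨ size-boundary G A ⟩
  sumOver A (degOut G A) ≡⟨ sumOver-ones A (degOut G A) one-outside ⟩
  count A                ≡⟨ |A|≡δ ⟩
  δ                      ∎
  where
  open ≡-Reasoning
  A = isA ∘ lab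
  one-outside : ∀ a → A a ≡ true → degOut G A a ≡ 1
  one-outside a Aa = trans (count-cong outside⇔B) (A-one-B a la)
    where
    la = isA⇒pA (lab a) Aa
    outside⇔B : ∀ w → not (isA (lab w)) ∧ adj G a w ≡ adj G a w ∧ isB (lab w)
    outside⇔B w with lab w in lw
    ... | pA = ≡.sym (∧-zeroʳ (adj G a w))
    ... | pB = ≡.sym (∧-identityʳ (adj G a w))
    ... | pC = trans (A-no-C a w la lw) (≡.sym (∧-zeroʳ (adj G a w)))

A-boundary-notStar : {G : Graph n} {δ : ℕ} {lab : Fin n → Part} → 2 ≤ δ → GoodPartition G δ lab →
                     ¬ (∃[ v ] IsStar G (boundary G (isA ∘ lab)) v)
A-boundary-notStar {n} {G} {δ} {lab} 2≤δ
  (|A|≡δ , A-clique , δ≤|B∪C| , A-one-B , _ , B-has-A , B-C-complete) (v , star) = by-part (lab v) refl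
  where
  A = isA ∘ lab
  ∂A = boundary G A
  touches : ∀ {x y} → mem ∂A x y ≡ true → x ≡ v ⊎ y ≡ v
  touches = isStar⇒touches {G = G} {∂A} star
  incident : ∀ {y} → adj G v y ≡ true → mem ∂A v y ≡ true
  incident = isStar⇒incident {G = G} {∂A} star
  labels-differ : ∀ {x y p q} → lab x ≡ p → lab y ≡ q → p ≢ q → x ≢ y
  labels-differ lx ly p≢q refl = p≢q (trans (≡.sym lx) ly)
  2≤|A| : 2 ≤ count A
  2≤|A| = subst (2 ≤_) (≡.sym |A|≡δ) 2≤δ

  by-part : ∀ p → lab v ≡ p → ⊥
  by-part pA lv with count-≥2⇒∃≢ A 2≤|A| v
  ... | a , Aa , a≢v = not-¬ (incident (A-clique v a lv (isA⇒pA (lab a) Aa) (a≢v ∘ ≡.sym)))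
                             (boundary-inside G A (cong isA lv) Aa)
  by-part pB lv with count-≥2⇒∃≢ (not ∘ A) (≤-trans 2≤δ δ≤|B∪C|) v
  ... | y , ¬Ay , y≢v with lab y in ly
  by-part pB lv | y , () , _ | pA
  ...   | pB = let a , la , Gya = B-has-A y ly in
               [ labels-differ la lv (λ ()) , y≢v ]′
                 (touches (boundary-separates G A a y (cong isA la) (cong isA ly) (trans (Graph.sym G a y) Gya)))
  ...   | pC = not-¬ (incident (B-C-complete v y lv ly)) (boundary-inside G A (cong isA lv) (cong isA ly))
  by-part pC lv with count-witness A (≤-trans (s≤s z≤n) 2≤|A|)
  ... | a , Aa with count-witness (λ w → adj G a w ∧ isB (lab w))
                                  (subst (1 ≤_) (≡.sym (A-one-B a (isA⇒pA (lab a) Aa))) ≤-refl)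
  ...   | b , Gab∧Bb =
    let Gab , Bb = ∧-true⇒ {adj G a b} Gab∧Bb
        la = isA⇒pA (lab a) Aa
        lb = isB⇒pB (lab b) Bb
    in [ labels-differ la lv (λ ()) , labels-differ lb lv (λ ()) ]′
         (touches (boundary-separates G A a b Aa (cong isA lb) Gab))

goodPartition⇒cut : {G : Graph n} {δ : ℕ} {lab : Fin n → Part} → 2 ≤ δ → GoodPartition G δ lab →
                    ∃[ F ] (IsEdgeCut G F × size F ≡ δ × ¬ (∃[ v ] IsStar G F v))
goodPartition⇒cut {G = G} {δ} {lab} 2≤δ good =
  boundary G (isA ∘ lab) ,
  A-boundary-isCut {G = G} {δ} {lab} (≤-trans (s≤s z≤n) 2≤δ) good ,
  size-A-boundary {G = G} {δ} {lab} good ,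
  A-boundary-notStar {G = G} {δ} {lab} 2≤δ good

proposition5 : ∀ {n} (G : Graph n) (δ : ℕ) →
    DiamAtMost2 G → IsMinDegree G δ → 2 ≤ δ →
    (∃[ F ] (IsEdgeCut G F × size F ≡ δ × ¬ (∃[ v ] IsStar G F v)))
      ⇔ (∃[ lab ] GoodPartition G δ lab)
proposition5 G δ diam (minDeg , _) 2≤δ =
  mk⇔ (cut⇒goodPartition diam minDeg) (λ (_ , good) → goodPartition⇒cut 2≤δ good)
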